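{- Let $n\ge 2$, let $\sigma$ be a prefix normal word chain generator of length $n$, let $j\in[n-1]$, and let $\sigma'$ be obtained from $\sigma$ by swapping the entries at positions $j$ and $j+1$ (so $\sigma'[j]=\sigma[j+1]$, $\sigma'[j+1]=\sigma[j]$, and $\sigma'[k]=\sigma[k]$ otherwise). Let $w=c_\sigma[j]$. Then $\sigma'$ is not a prefix normal word chain generator if and only if both: (1) $\sigma[j] > \sigma[j+1]$, and (2) there exists a factor $v=w[a..b]$ of $w$ such that $a\le\sigma[j]\le b$ and $\sigma[j+1]\notin[a,b]$ (i.e. $v$ includes index $\sigma[j]$ and does not include index $\sigma[j+1]$), $\sigma[j+1] \leq |v| < \sigma[j]$, and $|v|_1 \geq |\mathrm{pref}_{|v|}(w)|_1$.
   Context: Words are over $\{0,1\}$. For a word $w$, $|w|$ is its length, $|w|_1$ the number of $1$s, $\mathrm{pref}_k(w)$ the prefix of length $k$, and $w[a..b]$ the factor from position $a$ to position $b$. A word $w$ is prefix normal if every factor $v$ of $w$ satisfies $|v|_1 \le |\mathrm{pref}_{|v|}(w)|_1$. A permutation $\sigma$ of $[n]$ is written in one-line notation with $\sigma[i]=\sigma(i)$; it is called a (word chain) generator. Its word chain $c_\sigma=(c_\sigma[1],\dots,c_\sigma[n+1])$ consists of words of length $n$ with $c_\sigma[1]=1^n$ and $c_\sigma[i+1]$ obtained from $c_\sigma[i]$ by changing the letter at position $\sigma(i)$ from $1$ to $0$ ($i\in[n]$). The permutation $\sigma$ is a prefix normal (word chain) generator if all words $c_\sigma[i]$ are prefix normal.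 -}

module Defs where

open import Data.Nat using (ℕ; zero; suc; _+_; _∸_; _≤_; _<_; _<?_)
open import Data.Bool using (Bool; true; false)
open import Data.List using (List; []; _∷_; take; drop)
open import Data.Vec using (Vec; replicate; toList; _[_]≔_; length)
open import Data.Fin using (Fin; toℕ; fromℕ<)
open import Data.Fin.Permutation using (Permutation′; _⟨$⟩ʳ_; transpose; _∘ₚ_)
open import Relation.Nullary using (¬_; yes; no)
open import Data.Product using (∃-syntax; _×_)

-- Binary words: letters are Bool, with true = 1 and false = 0.
Word : ℕ → Set
Word n = Vec Bool n

ones : List Bool → ℕ
ones [] = 0
ones (true ∷ u) = suc (ones u)
ones (false ∷ u) = ones u

-- w[a..b] with 1-based positions a ≤ b  (the factor has length b - a + 1)
factor : {n : ℕ} → Word n → ℕ → ℕ → List Bool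
factor w a b = take (suc b ∸ a) (drop (a ∸ 1) (toList w))

pref : {n : ℕ} → ℕ → Word n → List Bool
pref k w = take k (toList w)

PrefixNormal : {n : ℕ} → Word n → Set
PrefixNormal {n} w =
  ∀ (a b : ℕ) → 1 ≤ a → a ≤ b → b ≤ n →
  ones (factor w a b) ≤ ones (pref (suc b ∸ a) w)

-- Word chain generators: permutations of [n], represented 0-based as
-- permutations of Fin n (Fin n index i stands for the number i + 1).
Generator : ℕ → Set
Generator n = Permutation′ n

-- One-line notation, 1-based:  σ[i] = σ(i) for 1 ≤ i ≤ n  (0 outside [n]).
at : {n : ℕ} → Generator n → ℕ → ℕ
at {n} σ zero = 0
at {n} σ (suc i) with i <? n
... | yes p = suc (toℕ (σ ⟨$⟩ʳ fromℕ< p))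
... | no _  = 0

-- chainStep σ k = c_σ[k+1]  (for 0 ≤ k ≤ n):
-- c_σ[1] = 1^n, and c_σ[i+1] is c_σ[i] with the letter at position σ(i) set to 0.
chainStep : {n : ℕ} → Generator n → ℕ → Word n
chainStep {n} σ zero = replicate n true
chainStep {n} σ (suc k) with k <? n
... | yes p = chainStep σ k [ σ ⟨$⟩ʳ fromℕ< p ]≔ false
... | no _  = chainStep σ k

chain : {n : ℕ} → Generator n → ℕ → Word n
chain σ i = chainStep σ (i ∸ 1)

IsPrefixNormalGenerator : {n : ℕ} → Generator n → Set
IsPrefixNormalGenerator {n} σ = ∀ (i : ℕ) → 1 ≤ i → i ≤ suc n → PrefixNormal (chain σ i)

-- σ with the entries at (0-based) positions p and q swapped:
-- (swapAt σ p q)(k) = σ(τ(k)) where τ is the transposition (p q).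
swapAt : {n : ℕ} → Generator n → Fin n → Fin n → Generator n
swapAt σ p q = transpose p q ∘ₚ σ

{-# OPTIONS --safe #-}
module Submission where

open import Defs
open import Data.Nat
  using (ℕ; zero; suc; _+_; _∸_; _≤_; _<_; _≥_; _>_; _≤′_; ≤′-refl; ≤′-step; z≤n; s≤s; s≤s⁻¹; _≤?_; _<?_; _≟_)
open import Data.Nat.Properties
  using ( ≤-refl; ≤-reflexive; ≤-trans; <-trans; <⇒≤; 1+n≰n; <-≤-trans; n≤1+n; m<n⇒m<1+n; ≮⇒≥; ≰⇒>; ≤∧≢⇒<
        ; m+[n∸m]≡n; ≤⇒≤′; ≤′⇒≤; +-comm; suc-injective; anyUpTo?)
open import Data.Bool using (Bool; true; false)
open import Data.List using (List; take; drop)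
open import Data.Vec using (_∷_; toList; lookup; _[_]≔_)
open import Data.Vec.Properties using (lookup-replicate; lookup∘update′; []≔-commutes)
open import Data.Fin using (Fin; zero; suc; toℕ; fromℕ<) renaming (_≟_ to _≟ᶠ_)
open import Data.Fin.Properties using (toℕ<n; fromℕ<-toℕ; toℕ-fromℕ<) renaming (<⇒≢ to <⇒≢ᶠ)
open import Data.Fin.Permutation using (_⟨$⟩ʳ_)
import Data.Fin.Permutation.Components as PC
open import Data.Product using (∃-syntax; _×_; _,_; proj₁; proj₂)
open import Data.Empty using (⊥-elim)
open import Function using (_∘_)
open import Function.Bundles using (_⇔_; mk⇔; Injection; Equivalence)
open import Function.Properties.Inverse using (↔⇒↣)
open import Relation.Nullary using (¬_; ¬?; yes; no; Dec; _×-dec_)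
open import Relation.Nullary.Decidable using (dec-true; dec-false; decidable-stable)
open import Relation.Binary.PropositionalEquality
  using (_≡_; _≢_; refl; sym; trans; cong; cong₂; subst; subst₂)

-- Swapping σ[j] and σ[j+1] changes exactly one word of the chain: w[σ[j]] := 0 is replaced by
-- u = w[σ[j+1]] := 0, where w = c_σ[j]. Clearing a 1 lowers the count of every window containing
-- it by one and leaves the other windows alone. As w is prefix normal, a factor v violating prefix
-- normality in u must avoid σ[j+1] while pref_|v| contains it, and |v|_1 = |pref_|v|(w)|_1. As the
-- next word u[σ[j]] := 0 = c_σ[j+2] is prefix normal again, v must contain σ[j] while pref_|v| does
-- not; hence σ[j+1] ≤ |v| < σ[j]. Conversely such a v violates prefix normality in u.

-- Positions are 0-based here: factor w a b is window (a ∸ 1) (suc b ∸ a) w and pref k w is window 0 k w.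
window : ∀ {n} → ℕ → ℕ → Word n → List Bool
window d k w = take k (drop d (toList w))

WindowNormal : ∀ {n} → ℕ → ℕ → Word n → Set
WindowNormal d k w = ones (window d k w) ≤ ones (window 0 k w)

InWindow : ℕ → ℕ → ℕ → Set
InWindow d k i = d ≤ i × i < d + k

inWindow? : ∀ d k i → Dec (InWindow d k i)
inWindow? d k i = (d ≤? i) ×-dec (i <? d + k)

inWindow⇔inFactor : ∀ {d b i} → d < b → InWindow d (b ∸ d) i ⇔ (suc d ≤ suc i × suc i ≤ b)
inWindow⇔inFactor {d} {b} {i} d<b = mk⇔
  (λ (d≤i , i<d+[b∸d]) → s≤s d≤i , subst (i <_) d+[b∸d]≡b i<d+[b∸d])
  (λ (1+d≤1+i , i<b) → s≤s⁻¹ 1+d≤1+i , subst (i <_) (sym d+[b∸d]≡b) i<b)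
  where
  d+[b∸d]≡b : d + (b ∸ d) ≡ b
  d+[b∸d]≡b = m+[n∸m]≡n (≤-trans (n≤1+n d) d<b)

ones-window-clear-∈ : ∀ {n} (w : Word n) (y : Fin n) {d k} → lookup w y ≡ true → InWindow d k (toℕ y) →
                      suc (ones (window d k (w [ y ]≔ false))) ≡ ones (window d k w)
ones-window-clear-∈ (true ∷ w) zero {zero} {suc k} refl _ = refl
ones-window-clear-∈ (true ∷ w) (suc y) {zero} {suc k} wy (_ , s≤s y<k) =
  cong suc (ones-window-clear-∈ w y {0} {k} wy (z≤n , y<k))
ones-window-clear-∈ (false ∷ w) (suc y) {zero} {suc k} wy (_ , s≤s y<k) =
  ones-window-clear-∈ w y {0} {k} wy (z≤n , y<k)
ones-window-clear-∈ (x ∷ w) (suc y) {suc d} {k} wy (s≤s d≤y , s≤s y<) =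
  ones-window-clear-∈ w y {d} {k} wy (d≤y , y<)

ones-window-clear-∉ : ∀ {n} (w : Word n) (y : Fin n) {d k} → ¬ InWindow d k (toℕ y) →
                      ones (window d k (w [ y ]≔ false)) ≡ ones (window d k w)
ones-window-clear-∉ w y {zero} {zero} _ = refl
ones-window-clear-∉ (x ∷ w) zero {zero} {suc k} y∉ = ⊥-elim (y∉ (z≤n , s≤s z≤n))
ones-window-clear-∉ (true ∷ w) (suc y) {zero} {suc k} y∉ =
  cong suc (ones-window-clear-∉ w y {0} {k} λ (_ , y<k) → y∉ (z≤n , s≤s y<k))
ones-window-clear-∉ (false ∷ w) (suc y) {zero} {suc k} y∉ =
  ones-window-clear-∉ w y {0} {k} λ (_ , y<k) → y∉ (z≤n , s≤s y<k)
ones-window-clear-∉ (x ∷ w) zero {suc d} y∉ = refl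
ones-window-clear-∉ (x ∷ w) (suc y) {suc d} {k} y∉ =
  ones-window-clear-∉ w y {d} {k} λ (d≤y , y<) → y∉ (s≤s d≤y , s≤s y<)

module _ {n} (w : Word n) (y : Fin n) (wy : lookup w y ≡ true) {d k : ℕ} where
  private
    w′ : Word n
    w′ = w [ y ]≔ false

    factor-∈ : InWindow d k (toℕ y) → suc (ones (window d k w′)) ≡ ones (window d k w)
    factor-∈ = ones-window-clear-∈ w y wy

    factor-∉ : ¬ InWindow d k (toℕ y) → ones (window d k w′) ≡ ones (window d k w)
    factor-∉ = ones-window-clear-∉ w y

    prefix-< : toℕ y < k → suc (ones (window 0 k w′)) ≡ ones (window 0 k w)
    prefix-< y<k = ones-window-clear-∈ w y {0} {k} wy (z≤n , y<k)

    prefix-≮ : ¬ toℕ y < k → ones (window 0 k w′) ≡ ones (window 0 k w)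
    prefix-≮ y≮k = ones-window-clear-∉ w y {0} {k} (y≮k ∘ proj₂)

  clearing-breaks-window : WindowNormal d k w → ¬ WindowNormal d k w′ →
                           ¬ InWindow d k (toℕ y) × toℕ y < k × ones (window 0 k w) ≤ ones (window d k w)
  clearing-breaks-window normal ¬normal′ with inWindow? d k (toℕ y) | toℕ y <? k
  ... | yes y∈ | yes y<k =
    ⊥-elim (¬normal′ (s≤s⁻¹ (subst₂ _≤_ (sym (factor-∈ y∈)) (sym (prefix-< y<k)) normal)))
  ... | yes y∈ | no y≮k =
    ⊥-elim (¬normal′ (≤-trans (n≤1+n _) (subst₂ _≤_ (sym (factor-∈ y∈)) (sym (prefix-≮ y≮k)) normal)))
  ... | no y∉ | no y≮k =
    ⊥-elim (¬normal′ (subst₂ _≤_ (sym (factor-∉ y∉)) (sym (prefix-≮ y≮k)) normal))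
  ... | no y∉ | yes y<k = y∉ , y<k , subst₂ _≤_ (prefix-< y<k) (factor-∉ y∉) (≰⇒> ¬normal′)

  clearing-breaks-window-if : ¬ InWindow d k (toℕ y) → toℕ y < k → ones (window 0 k w) ≤ ones (window d k w) →
                              ¬ WindowNormal d k w′
  clearing-breaks-window-if y∉ y<k prefix≤factor normal′ =
    1+n≰n (≤-trans (subst₂ _≤_ (sym (prefix-< y<k)) (sym (factor-∉ y∉)) prefix≤factor) normal′)

  clearing-repairs-window : ¬ WindowNormal d k w → WindowNormal d k w′ → InWindow d k (toℕ y) × k ≤ toℕ y
  clearing-repairs-window ¬normal normal′ with inWindow? d k (toℕ y) | toℕ y <? k
  ... | yes y∈ | no y≮k = y∈ , ≮⇒≥ y≮k
  ... | yes y∈ | yes y<k =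
    ⊥-elim (¬normal (subst₂ _≤_ (factor-∈ y∈) (prefix-< y<k) (s≤s normal′)))
  ... | no y∉ | yes y<k =
    ⊥-elim (¬normal (subst₂ _≤_ (factor-∉ y∉) (prefix-< y<k) (≤-trans normal′ (n≤1+n _))))
  ... | no y∉ | no y≮k =
    ⊥-elim (¬normal (subst₂ _≤_ (factor-∉ y∉) (prefix-≮ y≮k) normal′))

¬prefixNormal⇒violatedFactor : ∀ {n} (w : Word n) → ¬ PrefixNormal w →
                               ∃[ a ] ∃[ b ] (1 ≤ a × a ≤ b × b ≤ n × ¬ WindowNormal (a ∸ 1) (suc b ∸ a) w)
¬prefixNormal⇒violatedFactor {n} w ¬pn = extract (anyUpTo? (λ a → anyUpTo? (violated? a) (suc n)) (suc n))
  where
  Violated : ℕ → ℕ → Set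
  Violated a b = 1 ≤ a × a ≤ b × ¬ WindowNormal (a ∸ 1) (suc b ∸ a) w

  violated? : ∀ a b → Dec (Violated a b)
  violated? a b = (1 ≤? a) ×-dec (a ≤? b) ×-dec ¬? (_ ≤? _)

  extract : Dec (∃[ a ] a < suc n × ∃[ b ] b < suc n × Violated a b) →
            ∃[ a ] ∃[ b ] (1 ≤ a × a ≤ b × b ≤ n × ¬ WindowNormal (a ∸ 1) (suc b ∸ a) w)
  extract (yes (a , _ , b , b<1+n , 1≤a , a≤b , ¬normal)) = a , b , 1≤a , a≤b , s≤s⁻¹ b<1+n , ¬normal
  extract (no none) = ⊥-elim (¬pn λ a b 1≤a a≤b b≤n → decidable-stable (_ ≤? _) λ ¬normal →
                        none (a , s≤s (≤-trans a≤b b≤n) , b , s≤s b≤n , 1≤a , a≤b , ¬normal))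

⟨$⟩ʳ-injective : ∀ {n} (σ : Generator n) {x y} → σ ⟨$⟩ʳ x ≡ σ ⟨$⟩ʳ y → x ≡ y
⟨$⟩ʳ-injective σ = Injection.injective (↔⇒↣ σ)

transpose-matchˡ : ∀ {n} (i j : Fin n) → PC.transpose i j i ≡ j
transpose-matchˡ i j rewrite dec-true (i ≟ᶠ i) refl = refl

transpose-matchʳ : ∀ {n} (i j : Fin n) → j ≢ i → PC.transpose i j j ≡ i
transpose-matchʳ i j j≢i rewrite dec-false (j ≟ᶠ i) j≢i | dec-true (j ≟ᶠ j) refl = refl

transpose-mismatch : ∀ {n} (i j k : Fin n) → k ≢ i → k ≢ j → PC.transpose i j k ≡ k
transpose-mismatch i j k k≢i k≢j rewrite dec-false (k ≟ᶠ i) k≢i | dec-false (k ≟ᶠ j) k≢j = refl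

at-suc-toℕ : ∀ {n} (σ : Generator n) (x : Fin n) → at σ (suc (toℕ x)) ≡ suc (toℕ (σ ⟨$⟩ʳ x))
at-suc-toℕ {n} σ x with toℕ x <? n
... | yes x<n = cong (λ y → suc (toℕ (σ ⟨$⟩ʳ y))) (fromℕ<-toℕ x x<n)
... | no x≮n = ⊥-elim (x≮n (toℕ<n x))

chainStep-suc-toℕ : ∀ {n} (σ : Generator n) (x : Fin n) →
                    chainStep σ (suc (toℕ x)) ≡ chainStep σ (toℕ x) [ σ ⟨$⟩ʳ x ]≔ false
chainStep-suc-toℕ {n} σ x with toℕ x <? n
... | yes x<n = cong (λ y → chainStep σ (toℕ x) [ σ ⟨$⟩ʳ y ]≔ false) (fromℕ<-toℕ x x<n)
... | no x≮n = ⊥-elim (x≮n (toℕ<n x))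

lookup-chainStep-unvisited : ∀ {n} (σ : Generator n) {m} (x : Fin n) → m ≤ toℕ x →
                             lookup (chainStep σ m) (σ ⟨$⟩ʳ x) ≡ true
lookup-chainStep-unvisited σ {zero} x _ = lookup-replicate (σ ⟨$⟩ʳ x) true
lookup-chainStep-unvisited {n} σ {suc m} x m<x with m <? n
... | no _ = lookup-chainStep-unvisited σ x (≤-trans (n≤1+n m) m<x)
... | yes m<n = trans (lookup∘update′ (σm≢σx ∘ sym) (chainStep σ m) false)
                      (lookup-chainStep-unvisited σ x (≤-trans (n≤1+n m) m<x))
  where
  σm≢σx : σ ⟨$⟩ʳ fromℕ< m<n ≢ σ ⟨$⟩ʳ x
  σm≢σx eq = 1+n≰n (subst (suc m ≤_) x≡m m<x)
    where
    x≡m : toℕ x ≡ m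
    x≡m = trans (cong toℕ (sym (⟨$⟩ʳ-injective σ eq))) (toℕ-fromℕ< m<n)

chainStep-suc-cong : ∀ {n} (σ τ : Generator n) {m} → chainStep σ m ≡ chainStep τ m →
                     ((m<n : m < n) → σ ⟨$⟩ʳ fromℕ< m<n ≡ τ ⟨$⟩ʳ fromℕ< m<n) →
                     chainStep σ (suc m) ≡ chainStep τ (suc m)
chainStep-suc-cong {n} σ τ {m} eq agree with m <? n
... | yes m<n = cong₂ (λ v y → v [ y ]≔ false) eq (agree m<n)
... | no _ = eq

chainStep-cong-from : ∀ {n} (σ τ : Generator n) {l m} → l ≤′ m → chainStep σ l ≡ chainStep τ l →
                      (∀ x → l ≤ toℕ x → toℕ x < m → σ ⟨$⟩ʳ x ≡ τ ⟨$⟩ʳ x) →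
                      chainStep σ m ≡ chainStep τ m
chainStep-cong-from σ τ ≤′-refl eq _ = eq
chainStep-cong-from σ τ {l} {suc m} (≤′-step l≤′m) eq agree =
  chainStep-suc-cong σ τ (chainStep-cong-from σ τ l≤′m eq λ x l≤x x<m → agree x l≤x (m<n⇒m<1+n x<m))
    λ m<n → agree (fromℕ< m<n) (subst (l ≤_) (sym (toℕ-fromℕ< m<n)) (≤′⇒≤ l≤′m))
                               (subst (_< suc m) (sym (toℕ-fromℕ< m<n)) ≤-refl)

SwapObstruction : ∀ {n} → ℕ → ℕ → Word n → Set
SwapObstruction {n} x y w =
  (x > y) × (∃[ a ] ∃[ b ] (1 ≤ a × a ≤ b × b ≤ n
                            × a ≤ x × x ≤ b
                            × ¬ (a ≤ y × y ≤ b)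
                            × y ≤ suc b ∸ a × suc b ∸ a < x
                            × ones (factor w a b) ≥ ones (pref (suc b ∸ a) w)))

module AdjacentSwap {n} (σ : Generator n) (pn : IsPrefixNormalGenerator σ)
                    (p q : Fin n) (q≡1+p : toℕ q ≡ suc (toℕ p)) where

  σ′ : Generator n
  σ′ = swapAt σ p q

  p<q : toℕ p < toℕ q
  p<q = ≤-reflexive (sym q≡1+p)

  σ′-elsewhere : ∀ x → x ≢ p → x ≢ q → σ′ ⟨$⟩ʳ x ≡ σ ⟨$⟩ʳ x
  σ′-elsewhere x x≢p x≢q = cong (σ ⟨$⟩ʳ_) (transpose-mismatch p q x x≢p x≢q)

  w : Word n
  w = chainStep σ (toℕ p)

  -- The 0-based positions σ[j] − 1 and σ[j+1] − 1.
  t s : Fin n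
  t = σ ⟨$⟩ʳ p
  s = σ ⟨$⟩ʳ q

  t≢s : t ≢ s
  t≢s = <⇒≢ᶠ p<q ∘ ⟨$⟩ʳ-injective σ

  u : Word n
  u = w [ s ]≔ false

  chainStep-σ′-below : ∀ {m} → m ≤ toℕ p → chainStep σ′ m ≡ chainStep σ m
  chainStep-σ′-below m≤p = chainStep-cong-from σ′ σ (≤⇒≤′ z≤n) refl λ x _ x<m →
    σ′-elsewhere x (<⇒≢ᶠ (<-≤-trans x<m m≤p)) (<⇒≢ᶠ (<-≤-trans x<m (≤-trans m≤p (<⇒≤ p<q))))

  chainStep-σ′-middle : chainStep σ′ (suc (toℕ p)) ≡ u
  chainStep-σ′-middle = trans (chainStep-suc-toℕ σ′ p)
    (cong₂ (λ v y → v [ y ]≔ false) (chainStep-σ′-below ≤-refl) (cong (σ ⟨$⟩ʳ_) (transpose-matchˡ p q)))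

  chainStep-σ-after : chainStep σ (suc (toℕ q)) ≡ u [ t ]≔ false
  chainStep-σ-after = trans (chainStep-suc-toℕ σ q)
    (trans (cong (_[ s ]≔ false) (trans (cong (chainStep σ) q≡1+p) (chainStep-suc-toℕ σ p)))
           ([]≔-commutes w t s t≢s))

  chainStep-σ′-after : chainStep σ′ (suc (toℕ q)) ≡ u [ t ]≔ false
  chainStep-σ′-after = trans (chainStep-suc-toℕ σ′ q)
    (cong₂ (λ v y → v [ y ]≔ false) (trans (cong (chainStep σ′) q≡1+p) chainStep-σ′-middle)
           (cong (σ ⟨$⟩ʳ_) (transpose-matchʳ p q (<⇒≢ᶠ p<q ∘ sym))))

  chainStep-σ′-above : ∀ {m} → suc (toℕ q) ≤ m → chainStep σ′ m ≡ chainStep σ m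
  chainStep-σ′-above q<m =
    chainStep-cong-from σ′ σ (≤⇒≤′ q<m) (trans chainStep-σ′-after (sym chainStep-σ-after))
    λ x q<x _ → σ′-elsewhere x (<⇒≢ᶠ (<-trans p<q q<x) ∘ sym) (<⇒≢ᶠ q<x ∘ sym)

  chainStep-σ′-elsewhere : ∀ {m} → m ≢ suc (toℕ p) → chainStep σ′ m ≡ chainStep σ m
  chainStep-σ′-elsewhere {m} m≢1+p with m ≤? toℕ p
  ... | yes m≤p = chainStep-σ′-below m≤p
  ... | no m≰p = chainStep-σ′-above (subst (_< m) (sym q≡1+p) (≤∧≢⇒< (≰⇒> m≰p) (m≢1+p ∘ sym)))

  σ′-prefixNormal⇔prefixNormal-u : IsPrefixNormalGenerator σ′ ⇔ PrefixNormal u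
  σ′-prefixNormal⇔prefixNormal-u = mk⇔
    (λ pn′ → subst PrefixNormal chainStep-σ′-middle (pn′ (suc (suc (toℕ p))) (s≤s z≤n) (s≤s (toℕ<n p))))
    from
    where
    from : PrefixNormal u → IsPrefixNormalGenerator σ′
    from pn-u (suc m) _ m≤n with m ≟ suc (toℕ p)
    ... | yes refl = subst PrefixNormal (sym chainStep-σ′-middle) pn-u
    ... | no m≢1+p = subst PrefixNormal (sym (chainStep-σ′-elsewhere m≢1+p)) (pn (suc m) (s≤s z≤n) m≤n)

  σ-windowNormal : ∀ {m d b} → m ≤ n → d < b → b ≤ n → WindowNormal d (b ∸ d) (chainStep σ m)
  σ-windowNormal m≤n d<b b≤n = pn _ (s≤s z≤n) (s≤s m≤n) _ _ (s≤s z≤n) d<b b≤n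

  w-s : lookup w s ≡ true
  w-s = lookup-chainStep-unvisited σ q (<⇒≤ p<q)

  u-t : lookup u t ≡ true
  u-t = trans (lookup∘update′ t≢s w false) (lookup-chainStep-unvisited σ p ≤-refl)

  breaks⇒obstruction : ¬ IsPrefixNormalGenerator σ′ → SwapObstruction (suc (toℕ t)) (suc (toℕ s)) w
  breaks⇒obstruction ¬pn′ with ¬prefixNormal⇒violatedFactor u (¬pn′ ∘ Equivalence.from σ′-prefixNormal⇔prefixNormal-u)
  ... | suc d , b , _ , d<b , b≤n , ¬normal-u
      with clearing-breaks-window w s w-s (σ-windowNormal (<⇒≤ (toℕ<n p)) d<b b≤n) ¬normal-u
         | clearing-repairs-window u t u-t ¬normal-u
             (subst (WindowNormal d (b ∸ d)) chainStep-σ-after (σ-windowNormal (toℕ<n q) d<b b≤n))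
  ... | s∉ , s<k , prefix≤factor | t∈ , k≤t =
    s≤s (<-≤-trans s<k k≤t) , suc d , b , s≤s z≤n , d<b , b≤n , proj₁ t∈′ , proj₂ t∈′ ,
    s∉ ∘ Equivalence.from (inWindow⇔inFactor d<b) , s<k , s≤s k≤t , prefix≤factor
    where
    t∈′ : suc d ≤ suc (toℕ t) × suc (toℕ t) ≤ b
    t∈′ = Equivalence.to (inWindow⇔inFactor d<b) t∈

  obstruction⇒breaks : SwapObstruction (suc (toℕ t)) (suc (toℕ s)) w → ¬ IsPrefixNormalGenerator σ′
  obstruction⇒breaks (_ , suc d , b , _ , d<b , b≤n , _ , _ , s∉ , s<k , _ , prefix≤factor) pn′ =
    clearing-breaks-window-if w s w-s (s∉ ∘ Equivalence.to (inWindow⇔inFactor d<b)) s<k prefix≤factor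
      (Equivalence.to σ′-prefixNormal⇔prefixNormal-u pn′ (suc d) b (s≤s z≤n) d<b b≤n)

  breaks⇔obstruction : (¬ IsPrefixNormalGenerator σ′)
                       ⇔ SwapObstruction (at σ (suc (toℕ p))) (at σ (suc (toℕ q))) w
  breaks⇔obstruction = subst₂ (λ x y → (¬ IsPrefixNormalGenerator σ′) ⇔ SwapObstruction x y w)
    (sym (at-suc-toℕ σ p)) (sym (at-suc-toℕ σ q)) (mk⇔ breaks⇒obstruction obstruction⇒breaks)

mainTheorem5 : (n : ℕ) → n ≥ 2 → (σ : Generator n) → IsPrefixNormalGenerator σ →
    (j : ℕ) → 1 ≤ j → j ≤ n ∸ 1 →
    (p q : Fin n) → toℕ p + 1 ≡ j → toℕ q + 1 ≡ j + 1 →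
    (¬ IsPrefixNormalGenerator (swapAt σ p q))
    ⇔ ((at σ j > at σ (j + 1))
       × (∃[ a ] ∃[ b ] (1 ≤ a × a ≤ b × b ≤ n
           × a ≤ at σ j × at σ j ≤ b
           × ¬ (a ≤ at σ (j + 1) × at σ (j + 1) ≤ b)
           × at σ (j + 1) ≤ suc b ∸ a × suc b ∸ a < at σ j
           × ones (factor (chain σ j) a b) ≥ ones (pref (suc b ∸ a) (chain σ j)))))
-- The bounds on n and j are implied by p, q : Fin n.
mainTheorem5 n _ σ pn j _ _ p q p+1≡j q+1≡j+1 =
  subst₂ (λ i i′ → (¬ IsPrefixNormalGenerator (swapAt σ p q))
                   ⇔ SwapObstruction (at σ i) (at σ i′) (chain σ i))
    1+p≡j 1+q≡j+1 (AdjacentSwap.breaks⇔obstruction σ pn p q q≡1+p)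
  where
  1+p≡j : suc (toℕ p) ≡ j
  1+p≡j = trans (+-comm 1 (toℕ p)) p+1≡j
  1+q≡j+1 : suc (toℕ q) ≡ j + 1
  1+q≡j+1 = trans (+-comm 1 (toℕ q)) q+1≡j+1
  q≡1+p : toℕ q ≡ suc (toℕ p)
  q≡1+p = suc-injective (trans 1+q≡j+1 (trans (cong (_+ 1) (sym 1+p≡j)) (+-comm (suc (toℕ p)) 1)))
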